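{- For integers $h\geq 2$ and $k\geq 1$, if a graph $G$ contains $W\langle h,6k\rangle$ as a minor, then $G$ contains subgraphs $G'$ and $G''$, both containing $W\langle h,k\rangle$ as a minor, such that $|V(G')\cap V(G'')|\leq 1$.
   Context: Let $T\langle h,k\rangle$ be the rooted complete $k$-ary tree of depth $h$ (each non-leaf node has exactly $k$ children; depth is the number of vertices on a root-to-leaf path). The weak closure of a rooted tree $T$ is the graph on $V(T)$ where two vertices are adjacent iff one is a leaf and the other is one of its ancestors. $W\langle h,k\rangle$ denotes the weak closure of $T\langle h,k\rangle$. -}

module Defs where

open import Data.Nat using (ℕ; suc; _<_)
open import Data.Fin using (Fin)
open import Data.List using (List; []; length; _++_)
open import Data.Product using (Σ; ∃; _×_; _,_; proj₁)
open import Data.Sum using (_⊎_)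
open import Data.Unit using (⊤)
open import Relation.Nullary using (¬_)
open import Relation.Binary.PropositionalEquality using (_≡_; _≢_)

record Graph (V : Set) : Set₁ where
  field
    Adj    : V → V → Set
    sym    : ∀ {x y} → Adj x y → Adj y x
    irrefl : ∀ {x} → ¬ Adj x x
open Graph public

record Subgraph {V : Set} (G : Graph V) : Set₁ where
  field
    inV      : V → Set
    inE      : V → V → Set
    inE-sym  : ∀ {x y} → inE x y → inE y x
    inE-Adj  : ∀ {x y} → inE x y → Adj G x y
    inE-inVˡ : ∀ {x y} → inE x y → inV x
    inE-inVʳ : ∀ {x y} → inE x y → inV y
open Subgraph public

whole : ∀ {V} (G : Graph V) → Subgraph G
whole G = record
  { inV = λ _ → ⊤ ; inE = Adj G ; inE-sym = sym G ; inE-Adj = λ e → e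
  ; inE-inVˡ = λ _ → _ ; inE-inVʳ = λ _ → _ }

data Reach {V : Set} {G : Graph V} (S : Subgraph G) (B : V → Set) : V → V → Set where
  here : ∀ {x} → Reach S B x x
  step : ∀ {x y z} → inE S x y → B y → Reach S B y z → Reach S B x z

record MinorModel {V : Set} {G : Graph V} (S : Subgraph G)
                  (W : Set) (adj : W → W → Set) : Set₁ where
  field
    branch    : W → V → Set
    inS       : ∀ {i v} → branch i v → inV S v
    nonempty  : ∀ i → ∃ λ v → branch i v
    disjoint  : ∀ {i j v} → branch i v → branch j v → i ≡ j
    connected : ∀ {i u v} → branch i u → branch i v → Reach S (branch i) u v
    edges     : ∀ {i j} → adj i j →
                ∃ λ u → ∃ λ v → branch i u × branch j v × inE S u v

HasMinor : ∀ {V} {G : Graph V} → Subgraph G → (W : Set) → (W → W → Set) → Set₁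
HasMinor S W adj = MinorModel S W adj

-- Complete k-ary tree T⟨h,k⟩ of depth h: nodes are words over Fin k of length < h
-- (root = [], children of w are w ++ [i]); leaves are words of length h - 1.
TNode : ℕ → ℕ → Set
TNode h k = Σ (List (Fin k)) (λ w → length w < h)

IsLeaf : ∀ {h k} → TNode h k → Set
IsLeaf {h} (w , _) = suc (length w) ≡ h

Ancestor : ∀ {h k} → TNode h k → TNode h k → Set
Ancestor {k = k} (x , _) (y , _) = ∃ λ (s : List (Fin k)) → s ≢ [] × x ++ s ≡ y

WAdj : ∀ h k → TNode h k → TNode h k → Set
WAdj h k x y = (IsLeaf {h} {k} y × Ancestor x y) ⊎ (IsLeaf {h} {k} x × Ancestor y x)

module Submission where

-- Let M be a minor model of W⟨h, K⟩ in G, where K = 6k and h = d + 2, and let R be the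
-- branch set of the root.  Every leaf z of T⟨h, K⟩ is adjacent to the root in the weak
-- closure, so M has an edge from a vertex attach z of R to the branch set of z.  Fix a
-- rooted tree t inside R containing all these attachment vertices.  For a vertex set S,
-- a position of T⟨h, K⟩ is S-good if it is a leaf attached inside S, or if at least k of
-- its children are S-good; the weight Q S counts the S-good children of the root.  Q is
-- monotone, and since K ≥ 3k, three sets covering t are good at every position in turn,
-- so their weights sum to at least K = 3 · 2k.  The splitting lemma then cuts t into
-- connected parts A and B, meeting in at most one vertex, with Q A ≥ 2k and Q B ≥ 2k.
-- Choosing k A-good and k further B-good children of the root and descending through
-- good positions embeds T⟨h, k⟩ into T⟨h, K⟩ twice; taking A, resp. B, as the branch set
-- of the root and the branch sets of M elsewhere gives the two models.

open import Defs renaming (sym to adj-sym)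
open import Data.Nat
open import Data.Nat.Properties
open import Data.Nat.Solver using (module +-*-Solver)
open import Data.Bool using (Bool; true; false; _∧_; _∨_; not; if_then_else_)
open import Data.Fin using (Fin; zero; suc; toℕ; inject≤)
import Data.Fin.Properties as FinP
open import Data.List using (List; []; _∷_; _++_; [_]; length; take; drop; allFin; concatMap; map)
open import Data.List.Membership.Propositional using (_∈_; lose)
open import Data.List.Membership.Propositional.Properties using (∈-allFin; ∈-concatMap⁺; ∈-map⁺)
open import Data.List.Relation.Unary.Any using (here; there)
open import Data.List.Properties using (++-assoc; ++-identityʳ; take++drop≡id; length-drop; length-++; ∷-injectiveˡ; ∷-injectiveʳ)
open import Data.Product using (Σ; ∃; _×_; _,_; proj₁; proj₂)
open import Data.Sum using (_⊎_; inj₁; inj₂)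
open import Data.Empty using (⊥; ⊥-elim)
open import Function.Definitions using (Injective)
open import Relation.Nullary using (¬_; Dec; yes; no; does; contradiction)
open import Relation.Nullary.Decidable using (dec-true; dec-false)
open import Relation.Binary.PropositionalEquality hiding ([_])

-- Boolean predicates.  Vertex sets and sets of tree positions are Boolean-valued so
-- that they can be counted; these facts turn Boolean connectives into logic.

∧-intro : ∀ {a b} → a ≡ true → b ≡ true → a ∧ b ≡ true
∧-intro refl refl = refl

∧-elimˡ : ∀ {a b} → a ∧ b ≡ true → a ≡ true
∧-elimˡ {true} _ = refl

∧-elimʳ : ∀ {a b} → a ∧ b ≡ true → b ≡ true
∧-elimʳ {true} e = e

∨-introˡ : ∀ {a b} → a ≡ true → a ∨ b ≡ true
∨-introˡ refl = refl

∨-introʳ : ∀ {a b} → b ≡ true → a ∨ b ≡ true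
∨-introʳ {true} _ = refl
∨-introʳ {false} e = e

∨-elim : ∀ {a b} → a ∨ b ≡ true → a ≡ true ⊎ b ≡ true
∨-elim {true} _ = inj₁ refl
∨-elim {false} e = inj₂ e

not-elim : ∀ {a} → not a ≡ true → a ≡ false
not-elim {false} _ = refl

not-intro : ∀ {a} → a ≡ false → not a ≡ true
not-intro refl = refl

true≢false : ∀ {a} → a ≡ true → a ≡ false → ⊥
true≢false refl ()

-- case analysis on a Boolean expression without abstracting it in the goal
true-or-false : ∀ b → b ≡ true ⊎ b ≡ false
true-or-false true = inj₁ refl
true-or-false false = inj₂ refl

dec-sound : ∀ {A : Set} (a? : Dec A) → does a? ≡ true → A
dec-sound (yes a) _ = a

dec-refute : ∀ {A : Set} (a? : Dec A) → does a? ≡ false → ¬ A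
dec-refute (no ¬a) _ = ¬a

_=F_ : ∀ {m} → Fin m → Fin m → Bool
x =F y = does (x FinP.≟ y)

=F-sound : ∀ {m} {x y : Fin m} → x =F y ≡ true → x ≡ y
=F-sound {x = x} {y} = dec-sound (x FinP.≟ y)

=F-refl : ∀ {m} (x : Fin m) → x =F x ≡ true
=F-refl x = dec-true (x FinP.≟ x) refl

indicator : Bool → ℕ
indicator b = if b then 1 else 0

count : ∀ {m} → (Fin m → Bool) → ℕ
count {zero} P = 0
count {suc m} P = indicator (P zero) + count (λ i → P (suc i))

count-mono : ∀ {m} (P Q : Fin m → Bool) → (∀ i → P i ≡ true → Q i ≡ true) → count P ≤ count Q
count-mono {zero} P Q P⊆Q = z≤n
count-mono {suc m} P Q P⊆Q with P zero in p₀ | Q zero in q₀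
... | true  | true  = s≤s (count-mono _ _ (λ i → P⊆Q (suc i)))
... | false | true  = m≤n⇒m≤1+n (count-mono _ _ (λ i → P⊆Q (suc i)))
... | false | false = count-mono _ _ (λ i → P⊆Q (suc i))
... | true  | false = ⊥-elim (true≢false (P⊆Q zero p₀) q₀)

count-false : ∀ m → count {m} (λ _ → false) ≡ 0
count-false zero = refl
count-false (suc m) = count-false m

count-cover₃ : ∀ {m} (P Q R : Fin m → Bool) → (∀ i → P i ∨ Q i ∨ R i ≡ true) →
               m ≤ count P + count Q + count R
count-cover₃ {zero} P Q R cover = z≤n
count-cover₃ {suc m} P Q R cover =
  ≤-trans (+-mono-≤ (head (P zero) (Q zero) (R zero) (cover zero))
                    (count-cover₃ (λ i → P (suc i)) (λ i → Q (suc i)) (λ i → R (suc i)) (λ i → cover (suc i))))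
          (≤-reflexive (sym (interchange (indicator (P zero)) (indicator (Q zero)) (indicator (R zero)) _ _ _)))
  where
    head : ∀ p q r → p ∨ q ∨ r ≡ true → 1 ≤ indicator p + indicator q + indicator r
    head true  q r _ = s≤s z≤n
    head false true r _ = s≤s z≤n
    head false false true _ = s≤s z≤n

    interchange : ∀ a b c x y z → (a + x) + (b + y) + (c + z) ≡ (a + b + c) + (x + y + z)
    interchange = solve 6 (λ a b c x y z → (a :+ x) :+ (b :+ y) :+ (c :+ z) := (a :+ b :+ c) :+ (x :+ y :+ z)) refl
      where open +-*-Solver

count-∨ : ∀ {m} (P Q : Fin m → Bool) → count (λ i → P i ∨ Q i) ≤ count P + count Q
count-∨ {zero} P Q = z≤n
count-∨ {suc m} P Q with P zero | Q zero | count-∨ (λ i → P (suc i)) (λ i → Q (suc i))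
... | true  | true  | ih = s≤s (≤-trans (m≤n⇒m≤1+n ih) (≤-reflexive (sym (+-suc _ _))))
... | true  | false | ih = s≤s ih
... | false | true  | ih = ≤-trans (s≤s ih) (≤-reflexive (sym (+-suc _ _)))
... | false | false | ih = ih

count-∖ : ∀ {m} (P Q : Fin m → Bool) → count P ≤ count (λ i → P i ∧ not (Q i)) + count Q
count-∖ {zero} P Q = z≤n
count-∖ {suc m} P Q with P zero | Q zero | count-∖ (λ i → P (suc i)) (λ i → Q (suc i))
... | true  | true  | ih = ≤-trans (s≤s ih) (≤-reflexive (sym (+-suc _ _)))
... | true  | false | ih = s≤s ih
... | false | true  | ih = ≤-trans (m≤n⇒m≤1+n ih) (≤-reflexive (sym (+-suc _ _)))
... | false | false | ih = ih

count-singleton : ∀ {m} (c : Fin m) → count (λ j → c =F j) ≤ 1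
count-singleton {suc m} zero = s≤s (≤-reflexive (count-false m))
count-singleton {suc m} (suc c) =
  ≤-trans (count-mono (λ j → suc c =F suc j) (λ j → c =F j) shift) (count-singleton c)
  where
    shift : ∀ j → suc c =F suc j ≡ true → c =F j ≡ true
    shift j e = dec-true (c FinP.≟ j) (FinP.suc-injective (=F-sound e))

some : ∀ {m} → (Fin m → Bool) → Bool
some {zero} P = false
some {suc m} P = P zero ∨ some (λ i → P (suc i))

some-intro : ∀ {m} (P : Fin m → Bool) i → P i ≡ true → some P ≡ true
some-intro P zero e = ∨-introˡ e
some-intro P (suc i) e = ∨-introʳ {P zero} (some-intro (λ i → P (suc i)) i e)

some-elim : ∀ {m} (P : Fin m → Bool) → some P ≡ true → ∃ λ i → P i ≡ true
some-elim {suc m} P e with ∨-elim {P zero} e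
... | inj₁ p₀ = zero , p₀
... | inj₂ rest with some-elim (λ i → P (suc i)) rest
...   | i , p = suc i , p

image : ∀ {k m} → (Fin k → Fin m) → Fin m → Bool
image σ j = some (λ i → σ i =F j)

count-image : ∀ {k m} (σ : Fin k → Fin m) → count (image σ) ≤ k
count-image {zero} {m} σ = ≤-reflexive (count-false m)
count-image {suc k} σ =
  ≤-trans (count-∨ (λ j → σ zero =F j) (image (λ i → σ (suc i))))
          (+-mono-≤ (count-singleton (σ zero)) (count-image (λ i → σ (suc i))))

select : ∀ {m} (P : Fin m → Bool) j → j ≤ count P →
         Σ (Fin j → Fin m) λ σ → Injective _≡_ _≡_ σ × (∀ i → P (σ i) ≡ true)
select {zero} P zero _ = (λ ()) , (λ {i} → ⊥-elim (FinP.¬Fin0 i)) , λ ()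
select {suc m} P j le with P zero in p₀
select {suc m} P zero le | true = (λ ()) , (λ {i} → ⊥-elim (FinP.¬Fin0 i)) , λ ()
select {suc m} P (suc j) (s≤s le) | true with select (λ i → P (suc i)) j le
... | σ , σ-inj , σ-ok = σ′ , σ′-inj , σ′-ok
  where
    σ′ : Fin (suc j) → Fin (suc m)
    σ′ zero = zero
    σ′ (suc i) = suc (σ i)
    σ′-inj : Injective _≡_ _≡_ σ′
    σ′-inj {zero} {zero} e = refl
    σ′-inj {suc i} {suc i′} e = cong suc (σ-inj (FinP.suc-injective e))
    σ′-ok : ∀ i → P (σ′ i) ≡ true
    σ′-ok zero = p₀
    σ′-ok (suc i) = σ-ok i
select {suc m} P j le | false with select (λ i → P (suc i)) j le
... | σ , σ-inj , σ-ok = (λ i → suc (σ i)) , (λ e → σ-inj (FinP.suc-injective e)) , σ-ok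

record DisjointSelection {m} (k : ℕ) (P Q : Fin m → Bool) : Set where
  field
    σ       : Fin k → Fin m
    τ       : Fin k → Fin m
    σ-inj   : Injective _≡_ _≡_ σ
    τ-inj   : Injective _≡_ _≡_ τ
    σ-in    : ∀ i → P (σ i) ≡ true
    τ-in    : ∀ i → Q (τ i) ≡ true
    apart   : ∀ i j → σ i ≢ τ j

select-disjoint : ∀ {m} k (P Q : Fin m → Bool) → k ≤ count P → k + k ≤ count Q → DisjointSelection k P Q
select-disjoint k P Q kP 2kQ = record
  { σ = σ ; τ = proj₁ selQ ; σ-inj = σ-inj ; τ-inj = proj₁ (proj₂ selQ) ; σ-in = σ-in
  ; τ-in = λ j → ∧-elimˡ (proj₂ (proj₂ selQ) j) ; apart = apart }
  where
    selP = select P k kP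
    σ = proj₁ selP
    σ-inj = proj₁ (proj₂ selP)
    σ-in = proj₂ (proj₂ selP)
    Q∖σ : Fin _ → Bool
    Q∖σ j = Q j ∧ not (image σ j)
    -- k + k ≤ count Q ≤ count (Q ∖ image σ) + k
    enough : k ≤ count Q∖σ
    enough = +-cancelʳ-≤ k k (count Q∖σ)
               (≤-trans 2kQ (≤-trans (count-∖ Q (image σ)) (+-monoʳ-≤ (count Q∖σ) (count-image σ))))
    selQ = select Q∖σ k enough
    apart : ∀ i j → σ i ≢ proj₁ selQ j
    apart i j e = true≢false (some-intro (λ i′ → σ i′ =F proj₁ selQ j) i (subst (λ u → σ i =F u ≡ true) e (=F-refl (σ i))))
                             (not-elim (∧-elimʳ {Q (proj₁ selQ j)} (proj₂ (proj₂ selQ) j)))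

-- k members of P, listed injectively; when P has fewer than k members we fall back
-- to the first k elements of Fin K, so that the list is always defined and injective.
choose-by : ∀ {k K} → k ≤ K → (P : Fin K → Bool) → Dec (k ≤ count P) → Fin k → Fin K
choose-by {k} k≤K P (yes enough) = proj₁ (select P k enough)
choose-by {k} k≤K P (no _) i = inject≤ i k≤K

choose : ∀ {k K} → k ≤ K → (P : Fin K → Bool) → Fin k → Fin K
choose {k} k≤K P = choose-by k≤K P (k ≤? count P)

choose-inj : ∀ {k K} (k≤K : k ≤ K) (P : Fin K → Bool) → Injective _≡_ _≡_ (choose k≤K P)
choose-inj {k} k≤K P = by-cases (k ≤? count P)
  where
    by-cases : ∀ d → Injective _≡_ _≡_ (choose-by k≤K P d)
    by-cases (yes enough) e = proj₁ (proj₂ (select P k enough)) e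
    by-cases (no _) {i} {j} e = FinP.inject≤-injective k≤K k≤K i j e

choose-in : ∀ {k K} (k≤K : k ≤ K) (P : Fin K → Bool) → k ≤ count P → ∀ i → P (choose k≤K P i) ≡ true
choose-in {k} k≤K P enough = by-cases (k ≤? count P)
  where
    by-cases : ∀ d i → P (choose-by k≤K P d i) ≡ true
    by-cases (yes enough′) i = proj₂ (proj₂ (select P k enough′)) i
    by-cases (no short) i = contradiction enough short

argmax : ∀ {n} (P : Fin n → Bool) (f : Fin n → ℕ) x₀ → P x₀ ≡ true →
         ∃ λ v → P v ≡ true × (∀ w → P w ≡ true → f w ≤ f v)
argmax {n} P f x₀ p₀ with search (allFin n)
  where
    search : (L : List (Fin n)) →
             (∃ λ v → P v ≡ true × (∀ w → w ∈ L → P w ≡ true → f w ≤ f v)) ⊎ (∀ w → w ∈ L → P w ≡ false)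
    search [] = inj₂ (λ w ())
    search (y ∷ L) with P y in py | search L
    ... | false | inj₁ (v , pv , max) = inj₁ (v , pv , λ { w (here refl) e → ⊥-elim (true≢false e py) ; w (there w∈) e → max w w∈ e })
    ... | false | inj₂ none = inj₂ λ { w (here refl) → py ; w (there w∈) → none w w∈ }
    ... | true  | inj₂ none = inj₁ (y , py , λ { w (here refl) e → ≤-refl ; w (there w∈) e → ⊥-elim (true≢false e (none w w∈)) })
    ... | true  | inj₁ (v , pv , max) with f y ≤? f v
    ...   | yes y≤v = inj₁ (v , pv , λ { w (here refl) e → y≤v ; w (there w∈) e → max w w∈ e })
    ...   | no  y≰v = inj₁ (y , py , λ { w (here refl) e → ≤-refl ; w (there w∈) e → ≤-trans (max w w∈ e) (<⇒≤ (≰⇒> y≰v)) })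
... | inj₁ (v , pv , max) = v , pv , λ w e → max w (∈-allFin w) e
... | inj₂ none = ⊥-elim (true≢false p₀ (none x₀ (∈-allFin x₀)))

first-rise : (p : ℕ → Bool) → p 0 ≡ false → ∀ N → p N ≡ true → ∃ λ t → p t ≡ false × p (suc t) ≡ true
first-rise p p₀ zero pN = ⊥-elim (true≢false pN p₀)
first-rise p p₀ (suc N) pN with p N in pN′
... | false = N , pN′ , pN
... | true  = first-rise p p₀ N pN′

light-parts : ∀ {a b c m} → a < m → b < m → m + m + m ≤ a + b + c → m ≤ c
light-parts {a} {b} {c} {m} a<m b<m total with m ≤? c
... | yes m≤c = m≤c
... | no  m≰c = ⊥-elim (<⇒≱ (+-mono-< (+-mono-< a<m b<m) (≰⇒> m≰c)) total)

six-thirds : ∀ k → 6 * k ≡ (k + k + k) + (k + k + k)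
six-thirds = solve 1 (λ k → con 6 :* k := (k :+ k :+ k) :+ (k :+ k :+ k)) refl
  where open +-*-Solver

six-halves : ∀ k → 6 * k ≡ (k + k) + (k + k) + (k + k)
six-halves = solve 1 (λ k → con 6 :* k := (k :+ k) :+ (k :+ k) :+ (k :+ k)) refl
  where open +-*-Solver

words : ∀ {K} → ℕ → List (List (Fin K))
words zero = [] ∷ []
words {K} (suc ℓ) = concatMap (λ i → map (i ∷_) (words ℓ)) (allFin K)

words-complete : ∀ {K} ℓ (z : List (Fin K)) → length z ≡ ℓ → z ∈ words ℓ
words-complete zero [] _ = here refl
words-complete (suc ℓ) (i ∷ z) ℓ≡ =
  ∈-concatMap⁺ (λ j → map (j ∷_) (words ℓ))
    (lose {P = λ j → (i ∷ z) ∈ map (j ∷_) (words ℓ)} (∈-allFin i) (∈-map⁺ (i ∷_) (words-complete ℓ z (suc-injective ℓ≡))))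

proper-prefix-preserved : ∀ {A B : Set} (f : List A → List B) → (∀ u → length (f u) ≡ length u) →
                          (∀ x s → take (length x) (f (x ++ s)) ≡ f x) →
                          ∀ x s → s ≢ [] → ∃ λ s′ → s′ ≢ [] × f x ++ s′ ≡ f (x ++ s)
proper-prefix-preserved f f-length f-take x s s≢[] = s′ , s′≢[] , prefix
  where
    s′ = drop (length x) (f (x ++ s))
    prefix : f x ++ s′ ≡ f (x ++ s)
    prefix = begin
      f x ++ s′                                   ≡⟨ cong (_++ s′) (sym (f-take x s)) ⟩
      take (length x) (f (x ++ s)) ++ s′          ≡⟨ take++drop≡id (length x) (f (x ++ s)) ⟩
      f (x ++ s)                                  ∎
      where open ≡-Reasoning
    s′-length : length s′ ≡ length s
    s′-length = begin
      length s′                                   ≡⟨ length-drop (length x) (f (x ++ s)) ⟩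
      length (f (x ++ s)) ∸ length x              ≡⟨ cong (_∸ length x) (trans (f-length (x ++ s)) (length-++ x)) ⟩
      length x + length s ∸ length x              ≡⟨ m+n∸m≡n (length x) (length s) ⟩
      length s                                    ∎
      where open ≡-Reasoning
    s′≢[] : s′ ≢ []
    s′≢[] s′≡[] = s≢[] (length-zero s (trans (sym s′-length) (cong length s′≡[])))
      where
        length-zero : ∀ {C : Set} (xs : List C) → length xs ≡ 0 → xs ≡ []
        length-zero [] _ = refl

module Walks {n : ℕ} (G : Graph (Fin n)) where

  Walk : (Fin n → Set) → Fin n → Fin n → Set
  Walk P x y = Reach (whole G) P x y

  walk-snoc : ∀ {P x y z} → Walk P x y → Adj G y z → P z → Walk P x z
  walk-snoc here e pz = step e pz here
  walk-snoc (step e py w) e′ pz = step e py (walk-snoc w e′ pz)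

  walk-++ : ∀ {P x y z} → Walk P x y → Walk P y z → Walk P x z
  walk-++ here w = w
  walk-++ (step e py w) w′ = step e py (walk-++ w w′)

  walk-reverse : ∀ {P x y} → P x → Walk P x y → Walk P y x
  walk-reverse px here = here
  walk-reverse px (step e py w) = walk-snoc (walk-reverse py w) (adj-sym G e) px

  Connected : (Fin n → Set) → Set
  Connected P = ∀ {x y} → P x → P y → Walk P x y

  connected-via : ∀ {P} c → (∀ {x} → P x → Walk P x c) → Connected P
  connected-via c to-c px py = walk-++ (to-c px) (walk-reverse py (to-c py))

  induced : (Fin n → Set) → Subgraph G
  induced U = record
    { inV = U ; inE = λ x y → U x × U y × Adj G x y
    ; inE-sym = λ { (ux , uy , e) → uy , ux , adj-sym G e }
    ; inE-Adj = λ e → proj₂ (proj₂ e)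
    ; inE-inVˡ = proj₁ ; inE-inVʳ = λ e → proj₁ (proj₂ e) }

  induced-walk : ∀ {U P : Fin n → Set} {x y} → (∀ {z} → P z → U z) → P x → Walk P x y → Reach (induced U) P x y
  induced-walk P⊆U px here = here
  induced-walk P⊆U px (step e py w) = step (P⊆U px , P⊆U py , e) py (induced-walk P⊆U py w)

-- A tree is given by
-- its (decidable) vertex set and a parent function; ranks strictly decrease towards
-- the root, which makes "is a descendant of" decidable.
module RootedTrees {n : ℕ} (G : Graph (Fin n)) (R : Fin n → Set) (root : Fin n) (root∈R : R root) where
  open Walks G

  record RootedTree : Set where
    field
      member        : Fin n → Bool
      parent        : Fin n → Fin n
      rank          : Fin n → ℕ
      rank-bound    : ℕ
      member⊆R      : ∀ {x} → member x ≡ true → R x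
      root-member   : member root ≡ true
      parent-member : ∀ {x} → member x ≡ true → x ≢ root → member (parent x) ≡ true
      parent-rank   : ∀ {x} → member x ≡ true → x ≢ root → rank (parent x) < rank x
      parent-adj    : ∀ {x} → member x ≡ true → x ≢ root → Adj G x (parent x)
      rank<bound    : ∀ {x} → member x ≡ true → rank x < rank-bound
  -- (rank-bound supplies a fresh, larger rank for a new leaf)
  open RootedTree public

  _⊑_ : RootedTree → RootedTree → Set
  t ⊑ t′ = ∀ z → member t z ≡ true → member t′ z ≡ true

  ⊑-trans : ∀ {t t′ t″} → t ⊑ t′ → t′ ⊑ t″ → t ⊑ t″
  ⊑-trans e e′ z m = e′ z (e z m)

  trivial : RootedTree
  trivial = record
    { member = λ x → x =F root ; parent = λ x → x ; rank = λ _ → 0 ; rank-bound = 1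
    ; member⊆R = λ e → subst R (sym (=F-sound e)) root∈R
    ; root-member = =F-refl root
    ; parent-member = λ e x≢r → ⊥-elim (x≢r (=F-sound e))
    ; parent-rank = λ e x≢r → ⊥-elim (x≢r (=F-sound e))
    ; parent-adj = λ e x≢r → ⊥-elim (x≢r (=F-sound e))
    ; rank<bound = λ _ → s≤s z≤n }

  graft : (t : RootedTree) (y x : Fin n) → member t y ≡ false → member t x ≡ true → Adj G y x → R y →
          Σ RootedTree λ t′ → t ⊑ t′ × member t′ y ≡ true
  graft t y x y∉t x∈t y~x y∈R = t′ , extends , y∈t′
    where
      member′ = λ z → member t z ∨ (z =F y)
      parent′ = λ z → if z =F y then x else parent t z
      rank′   = λ z → if z =F y then rank-bound t else rank t z

      extends : ∀ z → member t z ≡ true → member′ z ≡ true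
      extends z e = ∨-introˡ e

      y∈t′ : member′ y ≡ true
      y∈t′ = ∨-introʳ {member t y} (=F-refl y)

      old≢y : ∀ {z} → member t z ≡ true → (z =F y) ≡ false
      old≢y {z} e = dec-false (z FinP.≟ y) λ { refl → true≢false e y∉t }

      old-or-new : ∀ {z} → member′ z ≡ true → (member t z ≡ true × (z =F y) ≡ false) ⊎ (z ≡ y)
      old-or-new {z} e with ∨-elim {member t z} e
      ... | inj₁ old = inj₁ (old , old≢y old)
      ... | inj₂ new = inj₂ (=F-sound new)

      t′ : RootedTree
      t′ = record
        { member = member′ ; parent = parent′ ; rank = rank′ ; rank-bound = suc (rank-bound t)
        ; member⊆R = λ {z} e → in-R z e
        ; root-member = extends root (root-member t)
        ; parent-member = λ {z} e z≢r → parent-in z e z≢r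
        ; parent-rank = λ {z} e z≢r → rank-drops z e z≢r
        ; parent-adj = λ {z} e z≢r → adjacent z e z≢r
        ; rank<bound = λ {z} e → bounded z e }
        where
          in-R : ∀ z → member′ z ≡ true → R z
          in-R z e with old-or-new e
          ... | inj₁ (old , _) = member⊆R t old
          ... | inj₂ refl = y∈R
          parent-in : ∀ z → member′ z ≡ true → z ≢ root → member′ (parent′ z) ≡ true
          parent-in z e z≢r with old-or-new e
          ... | inj₁ (old , z≢y) rewrite z≢y = extends _ (parent-member t old z≢r)
          ... | inj₂ refl rewrite =F-refl y = extends _ x∈t
          rank-drops : ∀ z → member′ z ≡ true → z ≢ root → rank′ (parent′ z) < rank′ z
          rank-drops z e z≢r with old-or-new e
          ... | inj₁ (old , z≢y) rewrite z≢y | old≢y (parent-member t old z≢r) = parent-rank t old z≢r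
          ... | inj₂ refl rewrite =F-refl y | old≢y x∈t = rank<bound t x∈t
          adjacent : ∀ z → member′ z ≡ true → z ≢ root → Adj G z (parent′ z)
          adjacent z e z≢r with old-or-new e
          ... | inj₁ (old , z≢y) rewrite z≢y = parent-adj t old z≢r
          ... | inj₂ refl rewrite =F-refl y = y~x
          bounded : ∀ z → member′ z ≡ true → rank′ z < suc (rank-bound t)
          bounded z e with old-or-new e
          ... | inj₁ (old , z≢y) rewrite z≢y = m≤n⇒m≤1+n (rank<bound t old)
          ... | inj₂ refl rewrite =F-refl y = ≤-refl

  absorb-walk : ∀ {x y} (t : RootedTree) → member t x ≡ true → Walk R x y →
                Σ RootedTree λ t′ → t ⊑ t′ × member t′ y ≡ true
  absorb-walk t x∈t here = t , (λ _ m → m) , x∈t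
  absorb-walk {x} t x∈t (step {y = y} e y∈R w) with member t y in y∈?t
  ... | true = absorb-walk t y∈?t w
  ... | false with graft t y x y∈?t x∈t (adj-sym G e) y∈R
  ... | t₁ , t⊑t₁ , y∈t₁ with absorb-walk t₁ y∈t₁ w
  ... | t₂ , t₁⊑t₂ , end∈t₂ = t₂ , ⊑-trans {t} {t₁} {t₂} t⊑t₁ t₁⊑t₂ , end∈t₂

  absorb : ∀ {A : Set} (f : A → Fin n) → (∀ a → Walk R root (f a)) → (t : RootedTree) → (as : List A) →
           Σ RootedTree λ t′ → t ⊑ t′ × (∀ a → a ∈ as → member t′ (f a) ≡ true)
  absorb f reach t [] = t , (λ _ m → m) , λ a ()
  absorb f reach t (a ∷ as) with absorb-walk t (root-member t) (reach a)
  ... | t₁ , t⊑t₁ , fa∈t₁ with absorb f reach t₁ as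
  ... | t₂ , t₁⊑t₂ , rest = t₂ , ⊑-trans {t} {t₁} {t₂} t⊑t₁ t₁⊑t₂ ,
                            λ { a (here refl) → t₁⊑t₂ _ fa∈t₁ ; a′ (there a′∈) → rest a′ a′∈ }

  module Descendants (t : RootedTree) where

    data _≼_ : Fin n → Fin n → Set where
      stay  : ∀ {y} → y ≼ y
      climb : ∀ {x y} → member t x ≡ true → x ≢ root → parent t x ≼ y → x ≼ y

    -- decided by climbing at most `fuel` steps, enough since ranks decrease
    ≼-decide : (fuel : ℕ) → ∀ x y → (member t x ≡ true → rank t x < fuel) → Dec (x ≼ y)
    ≼-decide fuel x y fuel-ok with x FinP.≟ y
    ... | yes refl = yes stay
    ... | no x≢y with member t x in x∈? | x FinP.≟ root
    ... | false | _ = no λ { stay → x≢y refl ; (climb x∈t _ _) → true≢false x∈t x∈? }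
    ... | true  | yes refl = no λ { stay → x≢y refl ; (climb _ r≢r _) → r≢r refl }
    ... | true  | no x≢r with fuel
    ...   | zero = ⊥-elim (n≮0 (fuel-ok refl))
    ...   | suc fuel′ with ≼-decide fuel′ (parent t x) y (λ _ → ≤-trans (parent-rank t x∈? x≢r) (s≤s⁻¹ (fuel-ok refl)))
    ...     | yes up = yes (climb x∈? x≢r up)
    ...     | no ¬up = no λ { stay → x≢y refl ; (climb _ _ up) → ¬up up }

    _≼?_ : ∀ x y → Dec (x ≼ y)
    x ≼? y = ≼-decide (suc (rank t x)) x y (λ _ → ≤-refl)

    subtree : Fin n → Fin n → Bool
    subtree y x = member t x ∧ does (x ≼? y)

    subtree-intro : ∀ {x y} → member t x ≡ true → x ≼ y → subtree y x ≡ true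
    subtree-intro {x} {y} x∈t x≼y = ∧-intro x∈t (dec-true (x ≼? y) x≼y)

    subtree-elim : ∀ {x y} → subtree y x ≡ true → x ≼ y
    subtree-elim {x} {y} e = dec-sound (x ≼? y) (∧-elimʳ {member t x} e)

    ≼-root : ∀ {x} → member t x ≡ true → x ≼ root
    ≼-root {x} x∈t = climb-from (suc (rank t x)) x x∈t ≤-refl
      where
        climb-from : (fuel : ℕ) → ∀ x → member t x ≡ true → rank t x < fuel → x ≼ root
        climb-from fuel x x∈t r<f with x FinP.≟ root
        ... | yes refl = stay
        ... | no x≢r with fuel
        ...   | zero = ⊥-elim (n≮0 r<f)
        ...   | suc fuel′ = climb x∈t x≢r (climb-from fuel′ (parent t x) (parent-member t x∈t x≢r)
                                            (≤-trans (parent-rank t x∈t x≢r) (s≤s⁻¹ r<f)))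

    IsChild : Fin n → Fin n → Set
    IsChild v c = member t c ≡ true × c ≢ root × parent t c ≡ v

    isChild : Fin n → Fin n → Bool
    isChild v c = member t c ∧ not (c =F root) ∧ (parent t c =F v)

    isChild-sound : ∀ {v c} → isChild v c ≡ true → IsChild v c
    isChild-sound {v} {c} e =
      ∧-elimˡ e ,
      (λ c≡r → true≢false (dec-true (c FinP.≟ root) c≡r) (not-elim (∧-elimˡ (∧-elimʳ {member t c} e)))) ,
      =F-sound (∧-elimʳ {not (c =F root)} (∧-elimʳ {member t c} e))

    isChild-complete : ∀ {v c} → IsChild v c → isChild v c ≡ true
    isChild-complete {v} {c} (c∈t , c≢r , refl) =
      ∧-intro c∈t (∧-intro (not-intro (dec-false (c FinP.≟ root) c≢r)) (=F-refl (parent t c)))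

    child-towards : ∀ {x v} → x ≼ v → x ≢ v → ∃ λ c → IsChild v c × x ≼ c
    child-towards stay x≢v = ⊥-elim (x≢v refl)
    child-towards {x} {v} (climb x∈t x≢r up) x≢v with parent t x FinP.≟ v
    ... | yes p≡v = x , (x∈t , x≢r , p≡v) , stay
    ... | no p≢v with child-towards up p≢v
    ...   | c , c-child , p≼c = c , c-child , climb x∈t x≢r p≼c

    climb-walk : ∀ {Q : Fin n → Set} {x y} → x ≼ y → Q x →
                 (∀ {z} → Q z → member t z ≡ true → z ≢ root → parent t z ≼ y → Q (parent t z)) →
                 Walk Q x y
    climb-walk stay qx closed = here
    climb-walk (climb x∈t x≢r up) qx closed =
      step (parent-adj t x∈t x≢r) (closed qx x∈t x≢r up) (climb-walk up (closed qx x∈t x≢r up) closed)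

-- Proof: take a deepest vertex v whose subtree has weight ≥ m, so that all subtrees
-- at children of v are light, and move the subtrees at the children of v, in order,
-- from A (initially t) to B (initially {v}) until the weight of A drops below m.
module Splitting {n : ℕ} (G : Graph (Fin n)) (R : Fin n → Set) (root : Fin n) (root∈R : R root)
                 (t : RootedTrees.RootedTree G R root root∈R)
                 (Q : (Fin n → Bool) → ℕ) (m : ℕ)
                 (Q-mono : ∀ {S S′} → (∀ x → S x ≡ true → S′ x ≡ true) → Q S ≤ Q S′)
                 (Q-cover₃ : ∀ {S₁ S₂ S₃} →
                    (∀ x → RootedTrees.member t x ≡ true → S₁ x ∨ S₂ x ∨ S₃ x ≡ true) →
                    m + m + m ≤ Q S₁ + Q S₂ + Q S₃) where
  open Walks G
  open RootedTrees G R root root∈R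
  open Descendants t

  record Split : Set where
    field
      A B     : Fin n → Bool
      hinge   : Fin n
      A⊆R     : ∀ {x} → A x ≡ true → R x
      B⊆R     : ∀ {x} → B x ≡ true → R x
      A-heavy : m ≤ Q A
      B-heavy : m ≤ Q B
      A∩B     : ∀ {x} → A x ≡ true → B x ≡ true → x ≡ hinge
      A-conn  : Connected (λ x → A x ≡ true)
      B-conn  : Connected (λ x → B x ≡ true)
      root∈A  : A root ≡ true
      hinge∈B : B hinge ≡ true

  tree-heavy : m ≤ Q (member t)
  tree-heavy with m ≤? Q (member t)
  ... | yes heavy = heavy
  ... | no  light = light-parts (≰⇒> light) (≰⇒> light) (Q-cover₃ (λ x e → ∨-introˡ e))

  -- Cutting t at a vertex v: for a threshold j, B j consists of v and the subtrees
  -- at the children of v of index ≥ j, and A j of the rest of t.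
  module Cut (v : Fin n) (v∈t : member t v ≡ true) where

    far : ℕ → Fin n → Bool
    far j x = some (λ c → isChild v c ∧ does (j ≤? toℕ c) ∧ does (x ≼? c))

    far-elim : ∀ {j x} → far j x ≡ true → ∃ λ c → IsChild v c × j ≤ toℕ c × x ≼ c
    far-elim {j} {x} e with some-elim _ e
    ... | c , p = c , isChild-sound (∧-elimˡ p) ,
                  dec-sound (j ≤? toℕ c) (∧-elimˡ (∧-elimʳ {isChild v c} p)) ,
                  dec-sound (x ≼? c) (∧-elimʳ {does (j ≤? toℕ c)} (∧-elimʳ {isChild v c} p))

    far-intro : ∀ {j x c} → IsChild v c → j ≤ toℕ c → x ≼ c → far j x ≡ true
    far-intro {j} {x} {c} child j≤c x≼c =
      some-intro (λ c → isChild v c ∧ does (j ≤? toℕ c) ∧ does (x ≼? c)) c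
        (∧-intro (isChild-complete child) (∧-intro (dec-true (j ≤? toℕ c) j≤c) (dec-true (x ≼? c) x≼c)))

    A B : ℕ → Fin n → Bool
    A j x = member t x ∧ not (far j x)
    B j x = (x =F v) ∨ (member t x ∧ far j x)

    module _ (j : ℕ) where

      -- A j is closed under parents, hence connected through the root
      A-parent : ∀ {z} → A j z ≡ true → member t z ≡ true → z ≢ root → A j (parent t z) ≡ true
      A-parent {z} z∈A z∈t z≢r with far j (parent t z) in far-p
      ... | false = ∧-intro (parent-member t z∈t z≢r) refl
      ... | true with far-elim {j} far-p
      ... | c , child , j≤c , p≼c =
            ⊥-elim (true≢false (far-intro {j} child j≤c (climb z∈t z≢r p≼c)) (not-elim (∧-elimʳ {member t z} z∈A)))

      root∈A : A j root ≡ true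
      root∈A with far j root in far-r
      ... | false = ∧-intro (root-member t) refl
      ... | true with far-elim {j} far-r
      ... | c , (_ , c≢r , _) , _ , stay = ⊥-elim (c≢r refl)
      ... | c , _ , _ , climb _ r≢r _ = ⊥-elim (r≢r refl)

      A-conn : Connected (λ x → A j x ≡ true)
      A-conn = connected-via root λ x∈A → climb-walk (≼-root (∧-elimˡ x∈A)) x∈A (λ z∈A z∈t z≢r _ → A-parent z∈A z∈t z≢r)

      v∈B : B j v ≡ true
      v∈B = ∨-introˡ (=F-refl v)

      -- a vertex below a child c of v climbs inside B j to c, then steps to v
      to-v : ∀ {x} → B j x ≡ true → Walk (λ z → B j z ≡ true) x v
      to-v {x} x∈B with ∨-elim {x =F v} x∈B
      ... | inj₁ x≡v = subst (Walk (λ z → B j z ≡ true) x) (=F-sound {x = x} {y = v} x≡v) here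
      ... | inj₂ x∈far with far-elim {j} (∧-elimʳ {member t x} x∈far)
      ... | c , child@(c∈t , c≢r , refl) , j≤c , x≼c =
            walk-snoc (climb-walk x≼c x∈B (λ {z} _ z∈t z≢r p≼c →
                         ∨-introʳ {parent t z =F parent t c} (∧-intro (parent-member t z∈t z≢r) (far-intro {j} child j≤c p≼c))))
                      (parent-adj t c∈t c≢r) v∈B

      B-conn : Connected (λ x → B j x ≡ true)
      B-conn = connected-via v to-v

      A∩B : ∀ {x} → A j x ≡ true → B j x ≡ true → x ≡ v
      A∩B {x} x∈A x∈B with ∨-elim {x =F v} x∈B
      ... | inj₁ x≡v = =F-sound x≡v
      ... | inj₂ x∈far = ⊥-elim (true≢false (∧-elimʳ {member t x} x∈far) (not-elim (∧-elimʳ {member t x} x∈A)))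

      B⊆t : ∀ {x} → B j x ≡ true → member t x ≡ true
      B⊆t {x} x∈B with ∨-elim {x =F v} x∈B
      ... | inj₁ x≡v = subst (λ u → member t u ≡ true) (sym (=F-sound x≡v)) v∈t
      ... | inj₂ x∈far = ∧-elimˡ x∈far

      cut : m ≤ Q (A j) → m ≤ Q (B j) → Split
      cut A-heavy B-heavy = record
        { A = A j ; B = B j ; hinge = v ; A⊆R = λ x∈A → member⊆R t (∧-elimˡ x∈A) ; B⊆R = λ x∈B → member⊆R t (B⊆t x∈B)
        ; A-heavy = A-heavy ; B-heavy = B-heavy ; A∩B = A∩B ; A-conn = A-conn ; B-conn = B-conn
        ; root∈A = root∈A ; hinge∈B = v∈B }

    far-step : ∀ {j x} → far j x ≡ true → far (suc j) x ≡ false → ∃ λ c → IsChild v c × toℕ c ≡ j × x ≼ c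
    far-step {j} {x} far-j near-suc-j with far-elim {j} far-j
    ... | c , child , j≤c , x≼c with suc j ≤? toℕ c
    ...   | yes j<c = ⊥-elim (true≢false (far-intro {suc j} child j<c x≼c) near-suc-j)
    ...   | no  j≮c = c , child , ≤-antisym (s≤s⁻¹ (≰⇒> j≮c)) j≤c , x≼c

  heavy : Fin n → Bool
  heavy v = member t v ∧ does (m ≤? Q (subtree v))

  root-heavy : heavy root ≡ true
  root-heavy = ∧-intro (root-member t)
    (dec-true (m ≤? _) (≤-trans tree-heavy (Q-mono (λ x x∈t → subtree-intro x∈t (≼-root x∈t)))))

  module Balanced (v : Fin n) (v∈t : member t v ≡ true) (v-heavy : m ≤ Q (subtree v))
                  (children-light : ∀ {c} → IsChild v c → Q (subtree c) < m) where
    open Cut v v∈t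

    -- past the last child nothing is far, so A is all of t
    A-final : m ≤ Q (A n)
    A-final = ≤-trans tree-heavy (Q-mono (λ x x∈t → ∧-intro x∈t (not-intro (nothing-far x))))
      where
        nothing-far : ∀ x → far n x ≡ false
        nothing-far x with far n x in far-x
        ... | false = refl
        ... | true with far-elim {n} {x} far-x
        ... | c , _ , n≤c , _ = ⊥-elim (<⇒≱ (FinP.toℕ<n c) n≤c)

    -- at threshold 0, B contains the whole subtree at v
    B-initial : m ≤ Q (B 0)
    B-initial = ≤-trans v-heavy (Q-mono (λ x x∈sub → below-v x (∧-elimˡ x∈sub) (subtree-elim x∈sub)))
      where
        below-v : ∀ x → member t x ≡ true → x ≼ v → B 0 x ≡ true
        below-v x x∈t x≼v = by-cases (x FinP.≟ v)
          where
            by-cases : Dec (x ≡ v) → B 0 x ≡ true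
            by-cases (yes x≡v) = subst (λ u → B 0 u ≡ true) (sym x≡v) (v∈B 0)
            by-cases (no x≢v) with child-towards x≼v x≢v
            ... | c , child , x≼c = ∨-introʳ {x =F v} (∧-intro x∈t (far-intro {0} child z≤n x≼c))

    -- Where the weight of A rises to m between j and j + 1, the child of index j
    -- exists; t is covered by A j, its light subtree and the rest of B (j + 1).
    at-rise : ∀ j → Q (A j) < m → m ≤ Q (A (suc j)) → Split
    at-rise j A-light A′-heavy with some (λ c → isChild v c ∧ does (toℕ c ≟ j)) in child-at-j
    ... | false = ⊥-elim (<⇒≱ (≤-<-trans (Q-mono A′⊆A) A-light) A′-heavy)
      where
        A′⊆A : ∀ x → A (suc j) x ≡ true → A j x ≡ true
        A′⊆A x x∈A′ with far j x in far-j
        ... | false = ∧-intro (∧-elimˡ x∈A′) refl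
        ... | true with far-step {j} {x} far-j (not-elim (∧-elimʳ {member t x} x∈A′))
        ... | c , child , c≡j , _ =
              ⊥-elim (true≢false (some-intro (λ c → isChild v c ∧ does (toℕ c ≟ j)) c
                                   (∧-intro (isChild-complete child) (dec-true (toℕ c ≟ j) c≡j))) child-at-j)
    ... | true with some-elim (λ c → isChild v c ∧ does (toℕ c ≟ j)) child-at-j
    ... | c , c-at-j = cut (suc j) A′-heavy (≤-trans rest-heavy (Q-mono (λ x e → ∨-introʳ {x =F v} e)))
      where
        child : IsChild v c
        child = isChild-sound (∧-elimˡ c-at-j)
        rest : Fin n → Bool
        rest x = member t x ∧ far (suc j) x
        covers : ∀ x → member t x ≡ true → A j x ∨ subtree c x ∨ rest x ≡ true
        covers x x∈t with true-or-false (far j x) | true-or-false (far (suc j) x)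
        ... | inj₂ near-j | _ = ∨-introˡ (∧-intro x∈t (not-intro near-j))
        ... | inj₁ far-j | inj₁ far-suc-j = ∨-introʳ {A j x} (∨-introʳ {subtree c x} (∧-intro x∈t far-suc-j))
        ... | inj₁ far-j | inj₂ far-suc-j with far-step {j} {x} far-j far-suc-j
        ...   | c′ , _ , c′≡j , x≼c′ with FinP.toℕ-injective (trans c′≡j (sym (dec-sound (toℕ c ≟ j) (∧-elimʳ {isChild v c} c-at-j))))
        ...     | refl = ∨-introʳ {A j x} (∨-introˡ (subtree-intro x∈t x≼c′))
        rest-heavy : m ≤ Q rest
        rest-heavy = light-parts A-light (children-light child) (Q-cover₃ covers)

    split : Split
    split with m ≤? Q (A 0)
    ... | yes A₀-heavy = cut 0 A₀-heavy B-initial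
    ... | no  A₀-light with first-rise (λ j → does (m ≤? Q (A j))) (dec-false (m ≤? Q (A 0)) A₀-light) n (dec-true (m ≤? Q (A n)) A-final)
    ...   | j , before , after = at-rise j (≰⇒> (dec-refute (m ≤? Q (A j)) before)) (dec-sound (m ≤? Q (A (suc j))) after)

  split : Split
  split with argmax heavy (rank t) root root-heavy
  ... | v , v-heavy , deepest =
        Balanced.split v (∧-elimˡ v-heavy) (dec-sound (m ≤? Q (subtree v)) (∧-elimʳ {member t v} v-heavy)) children-light
    where
      children-light : ∀ {c} → IsChild v c → Q (subtree c) < m
      children-light {c} (c∈t , c≢r , refl) with m ≤? Q (subtree c)
      ... | no  light = ≰⇒> light
      ... | yes heavy-c = ⊥-elim (<⇒≱ (parent-rank t c∈t c≢r) (deepest c (∧-intro c∈t (dec-true (m ≤? Q (subtree c)) heavy-c))))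

module Weights {n : ℕ} (K k d : ℕ) (attach : List (Fin K) → Fin n) where

  good : (Fin n → Bool) → ℕ → List (Fin K) → Bool
  good S zero z = S (attach z)
  good S (suc r) z = does (k ≤? count (λ i → good S r (z ++ [ i ])))

  Q : (Fin n → Bool) → ℕ
  Q S = count (λ i → good S d [ i ])

  good-mono : ∀ {S S′} → (∀ x → S x ≡ true → S′ x ≡ true) → ∀ r z → good S r z ≡ true → good S′ r z ≡ true
  good-mono S⊆S′ zero z e = S⊆S′ _ e
  good-mono {S} {S′} S⊆S′ (suc r) z e =
    dec-true (k ≤? _) (≤-trans (dec-sound (k ≤? _) e)
      (count-mono (λ i → good S r (z ++ [ i ])) (λ i → good S′ r (z ++ [ i ])) (λ i → good-mono S⊆S′ r (z ++ [ i ]))))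

  Q-mono : ∀ {S S′} → (∀ x → S x ≡ true → S′ x ≡ true) → Q S ≤ Q S′
  Q-mono {S} {S′} S⊆S′ = count-mono (λ i → good S d [ i ]) (λ i → good S′ d [ i ]) (λ i → good-mono S⊆S′ d [ i ])

  module _ (K≥3k : k + k + k ≤ K) {S₁ S₂ S₃ : Fin n → Bool}
           (cover : ∀ z → S₁ (attach z) ∨ S₂ (attach z) ∨ S₃ (attach z) ≡ true) where

    good-cover₃ : ∀ r z → good S₁ r z ∨ good S₂ r z ∨ good S₃ r z ≡ true
    good-cover₃ zero z = cover z
    good-cover₃ (suc r) z = one-heavy (k ≤? count (child S₁)) (k ≤? count (child S₂)) (k ≤? count (child S₃))
      where
        child : (Fin n → Bool) → Fin K → Bool
        child S i = good S r (z ++ [ i ])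
        -- the K children of z are covered, so not all three counts can be below k
        one-heavy : (d₁ : Dec (k ≤ count (child S₁))) (d₂ : Dec (k ≤ count (child S₂))) (d₃ : Dec (k ≤ count (child S₃))) →
                    does d₁ ∨ does d₂ ∨ does d₃ ≡ true
        one-heavy (yes _) _ _ = refl
        one-heavy (no _) (yes _) _ = refl
        one-heavy (no _) (no _) (yes _) = refl
        one-heavy (no light₁) (no light₂) (no light₃) =
          contradiction (light-parts (≰⇒> light₁) (≰⇒> light₂)
                           (≤-trans K≥3k (count-cover₃ (child S₁) (child S₂) (child S₃) (λ i → good-cover₃ r (z ++ [ i ])))))
                        light₃

    Q-cover₃ : K ≤ Q S₁ + Q S₂ + Q S₃
    Q-cover₃ = count-cover₃ (λ i → good S₁ d [ i ]) (λ i → good S₂ d [ i ]) (λ i → good S₃ d [ i ]) (λ i → good-cover₃ d [ i ])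

  -- Following S-good positions, T⟨d + 2, k⟩ embeds into T⟨d + 2, K⟩: the root's children
  -- are sent along an injective σ to good children of the root, and below them each
  -- good position's children are sent to k of its good children.
  module Embedding (k≤K : k ≤ K) (S : Fin n → Bool) (σ : Fin k → Fin K) (σ-inj : Injective _≡_ _≡_ σ)
                   (σ-good : ∀ i → good S d [ σ i ] ≡ true) where

    good-children : ℕ → List (Fin K) → Fin K → Bool
    good-children r z j = good S (pred r) (z ++ [ j ])

    φ : ℕ → List (Fin K) → List (Fin k) → List (Fin K)
    φ r z [] = []
    φ r z (i ∷ u) = c ∷ φ (pred r) (z ++ [ c ]) u
      where c = choose k≤K (good-children r z) i

    Φ : List (Fin k) → List (Fin K)
    Φ [] = []
    Φ (i ∷ u) = σ i ∷ φ d [ σ i ] u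

    φ-length : ∀ r z u → length (φ r z u) ≡ length u
    φ-length r z [] = refl
    φ-length r z (i ∷ u) = cong suc (φ-length _ _ u)

    Φ-length : ∀ u → length (Φ u) ≡ length u
    Φ-length [] = refl
    Φ-length (i ∷ u) = cong suc (φ-length _ _ u)

    φ-inj : ∀ r z u u′ → φ r z u ≡ φ r z u′ → u ≡ u′
    φ-inj r z [] [] e = refl
    φ-inj r z (i ∷ u) (i′ ∷ u′) e with choose-inj k≤K (good-children r z) (∷-injectiveˡ e)
    ... | refl = cong (i ∷_) (φ-inj _ _ u u′ (∷-injectiveʳ e))

    Φ-inj : ∀ u u′ → Φ u ≡ Φ u′ → u ≡ u′
    Φ-inj [] [] e = refl
    Φ-inj (i ∷ u) (i′ ∷ u′) e with σ-inj (∷-injectiveˡ e)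
    ... | refl = cong (i ∷_) (φ-inj _ _ u u′ (∷-injectiveʳ e))

    φ-take : ∀ r z x s → take (length x) (φ r z (x ++ s)) ≡ φ r z x
    φ-take r z [] s = refl
    φ-take r z (i ∷ x) s = cong (_ ∷_) (φ-take _ _ x s)

    Φ-take : ∀ x s → take (length x) (Φ (x ++ s)) ≡ Φ x
    Φ-take [] s = refl
    Φ-take (i ∷ x) s = cong (_ ∷_) (φ-take _ _ x s)

    φ-good : ∀ r z u → good S r z ≡ true → length u ≤ r → good S (r ∸ length u) (z ++ φ r z u) ≡ true
    φ-good r z [] z-good _ = subst (λ w → good S r w ≡ true) (sym (++-identityʳ z)) z-good
    φ-good (suc r) z (i ∷ u) z-good (s≤s ℓ≤r) =
      subst (λ w → good S (r ∸ length u) w ≡ true) (++-assoc z [ c ] (φ r (z ++ [ c ]) u))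
            (φ-good r (z ++ [ c ]) u (choose-in k≤K (good-children (suc r) z) (dec-sound (k ≤? _) z-good) i) ℓ≤r)
      where c = choose k≤K (good-children (suc r) z) i

    Φ-leaf : ∀ i u → length u ≡ d → S (attach (Φ (i ∷ u))) ≡ true
    Φ-leaf i u ℓ≡d = subst (λ r → good S r (Φ (i ∷ u)) ≡ true) (trans (cong (d ∸_) ℓ≡d) (n∸n≡0 d))
                       (φ-good d [ σ i ] u (σ-good i) (≤-reflexive ℓ≡d))

module Assembly (d k n : ℕ) (G : Graph (Fin n))
                (M : MinorModel (whole G) (TNode (suc (suc d)) (6 * k)) (WAdj (suc (suc d)) (6 * k))) where
  open Walks G
  open MinorModel M renaming (branch to brM)

  h : ℕ
  h = suc (suc d)

  K : ℕ
  K = 6 * k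

  node-≡ : ∀ {m} {u u′ : List (Fin m)} {p : length u < h} {p′ : length u′ < h} → u ≡ u′ →
           _≡_ {A = TNode h m} (u , p) (u′ , p′)
  node-≡ {u = u} {p = p} {p′} refl = cong (u ,_) (<-irrelevant p p′)

  root-node : TNode h K
  root-node = [] , s≤s z≤n

  R : Fin n → Set
  R = brM root-node

  b : Fin n
  b = proj₁ (nonempty root-node)

  b∈R : R b
  b∈R = proj₂ (nonempty root-node)

  apart-from-R : ∀ {x c w p} → R x → brM (c ∷ w , p) x → ⊥
  apart-from-R x∈R x∈c with disjoint x∈R x∈c
  ... | ()

  IsLeafWord : List (Fin K) → Set
  IsLeafWord z = length z ≡ suc d

  leaf-node : ∀ z → IsLeafWord z → TNode h K
  leaf-node z ℓ = z , s≤s (≤-reflexive ℓ)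

  -- In W⟨h, K⟩ the root is adjacent to every leaf, so M has an edge from R to each leaf.
  leaf-edge : ∀ z (ℓ : IsLeafWord z) → ∃ λ u → ∃ λ y → R u × brM (leaf-node z ℓ) y × Adj G u y
  leaf-edge z ℓ = edges {root-node} {leaf-node z ℓ} (inj₁ (cong suc ℓ , z , nonempty-word ℓ , refl))
    where
      nonempty-word : ∀ {z} → IsLeafWord z → z ≢ []
      nonempty-word () refl

  -- attach z: the end in R of that edge for a leaf z, and b for any other word
  attach-by : ∀ z → Dec (IsLeafWord z) → Fin n
  attach-by z (yes ℓ) = proj₁ (leaf-edge z ℓ)
  attach-by z (no _) = b

  attach : List (Fin K) → Fin n
  attach z = attach-by z (length z ≟ suc d)

  attach∈R : ∀ z → R (attach z)
  attach∈R z = by-cases (length z ≟ suc d)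
    where
      by-cases : ∀ dec → R (attach-by z dec)
      by-cases (yes ℓ) = proj₁ (proj₂ (proj₂ (leaf-edge z ℓ)))
      by-cases (no _) = b∈R

  attach-non-leaf : ∀ z → ¬ IsLeafWord z → attach z ≡ b
  attach-non-leaf z ¬ℓ = by-cases (length z ≟ suc d)
    where
      by-cases : ∀ dec → attach-by z dec ≡ b
      by-cases (yes ℓ) = contradiction ℓ ¬ℓ
      by-cases (no _) = refl

  attach-edge : ∀ z (ℓ : IsLeafWord z) → ∃ λ y → brM (leaf-node z ℓ) y × Adj G (attach z) y
  attach-edge z ℓ = by-cases (length z ≟ suc d)
    where
      by-cases : ∀ dec → ∃ λ y → brM (leaf-node z ℓ) y × Adj G (attach-by z dec) y
      by-cases (yes ℓ′) with leaf-edge z ℓ′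
      ... | _ , y , _ , y∈leaf , u~y = y , subst (λ t → brM t y) (node-≡ refl) y∈leaf , u~y
      by-cases (no ¬ℓ) = contradiction ℓ ¬ℓ

  open RootedTrees G R b b∈R

  absorbed : Σ RootedTree λ t → trivial ⊑ t × (∀ z → z ∈ words (suc d) → member t (attach z) ≡ true)
  absorbed = absorb attach (λ z → connected b∈R (attach∈R z)) trivial (words (suc d))

  tree : RootedTree
  tree = proj₁ absorbed

  attach∈tree : ∀ z → member tree (attach z) ≡ true
  attach∈tree z = by-cases (length z ≟ suc d)
    where
      by-cases : Dec (IsLeafWord z) → member tree (attach z) ≡ true
      by-cases (yes ℓ) = proj₂ (proj₂ absorbed) z (words-complete (suc d) z ℓ)
      by-cases (no ¬ℓ) = subst (λ u → member tree u ≡ true) (sym (attach-non-leaf z ¬ℓ)) (root-member tree)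

  open Weights K k d attach

  K≥3k : k + k + k ≤ K
  K≥3k = ≤-trans (m≤m+n (k + k + k) (k + k + k)) (≤-reflexive (sym (six-thirds k)))

  tree-cover₃ : ∀ {S₁ S₂ S₃} → (∀ x → member tree x ≡ true → S₁ x ∨ S₂ x ∨ S₃ x ≡ true) →
                (k + k) + (k + k) + (k + k) ≤ Q S₁ + Q S₂ + Q S₃
  tree-cover₃ {S₁} {S₂} {S₃} cover =
    subst (_≤ Q S₁ + Q S₂ + Q S₃) (six-halves k) (Q-cover₃ K≥3k (λ z → cover (attach z) (attach∈tree z)))

  open Splitting G R b b∈R tree Q (k + k) Q-mono tree-cover₃
  open Split split

  selection : DisjointSelection k (λ i → good A d [ i ]) (λ i → good B d [ i ])
  selection = select-disjoint k _ _ (≤-trans (m≤m+n k k) A-heavy) B-heavy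
  open DisjointSelection selection

  k≤K : k ≤ K
  k≤K = m≤n*m k 6

  -- One half of the result: the root of T⟨h,k⟩ is sent to a part S of R, the other nodes u
  -- to the branch sets of Φ u, in the subgraph induced by S and the branch sets below
  -- the chosen children of the root.
  module Half (S : Fin n → Bool) (S⊆R : ∀ {x} → S x ≡ true → R x) (S-conn : Connected (λ x → S x ≡ true))
              (x₀ : Fin n) (x₀∈S : S x₀ ≡ true)
              (ρ : Fin k → Fin K) (ρ-inj : Injective _≡_ _≡_ ρ) (ρ-good : ∀ i → good S d [ ρ i ] ≡ true) where
    open Embedding k≤K S ρ ρ-inj ρ-good

    BelowChosen : Fin n → Set
    BelowChosen x = Σ (Fin k) λ i → Σ (List (Fin K)) λ w → Σ (length (ρ i ∷ w) < h) λ p → brM (ρ i ∷ w , p) x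

    Vertex : Fin n → Set
    Vertex x = (S x ≡ true) ⊎ BelowChosen x

    half : Subgraph G
    half = induced Vertex

    embed : TNode h k → TNode h K
    embed (u , p) = Φ u , subst (_< h) (sym (Φ-length u)) p

    branch : TNode h k → Fin n → Set
    branch ([] , _) x = S x ≡ true
    branch (i ∷ u , p) x = brM (embed (i ∷ u , p)) x

    branch⊆Vertex : ∀ {t x} → branch t x → Vertex x
    branch⊆Vertex {[] , _} x∈S = inj₁ x∈S
    branch⊆Vertex {i ∷ u , p} x∈br = inj₂ (i , φ d [ ρ i ] u , proj₂ (embed (i ∷ u , p)) , x∈br)

    branch-disjoint : ∀ {t t′ x} → branch t x → branch t′ x → t ≡ t′
    branch-disjoint {[] , _} {[] , _} _ _ = node-≡ refl
    branch-disjoint {[] , _} {_ ∷ _ , _} x∈S x∈br = ⊥-elim (apart-from-R (S⊆R x∈S) x∈br)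
    branch-disjoint {_ ∷ _ , _} {[] , _} x∈br x∈S = ⊥-elim (apart-from-R (S⊆R x∈S) x∈br)
    branch-disjoint {i ∷ u , _} {i′ ∷ u′ , _} x∈br x∈br′ = node-≡ (Φ-inj _ _ (cong proj₁ (disjoint x∈br x∈br′)))

    branch-nonempty : ∀ t → ∃ λ x → branch t x
    branch-nonempty ([] , _) = x₀ , x₀∈S
    branch-nonempty (i ∷ u , p) = nonempty (embed (i ∷ u , p))

    branch-connected : ∀ {t x y} → branch t x → branch t y → Reach half (branch t) x y
    branch-connected {[] , _} x∈S y∈S = induced-walk inj₁ x∈S (S-conn x∈S y∈S)
    branch-connected {i ∷ u , p} x∈br y∈br = induced-walk (branch⊆Vertex {i ∷ u , p}) x∈br (connected x∈br y∈br)

    Φ-leaf-length : ∀ {u p} → IsLeaf {h} {k} (u , p) → IsLeafWord (Φ u)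
    Φ-leaf-length {u} leaf = trans (Φ-length u) (suc-injective leaf)

    BranchEdge : TNode h k → TNode h k → Set
    BranchEdge t t′ = ∃ λ a → ∃ λ c → branch t a × branch t′ c × inE half a c

    -- An ancestor t of a leaf t′ of T⟨h,k⟩ has an edge to it: from S along the
    -- attachment edge of the leaf Φ t′ if t is the root, and from M otherwise.
    edge-to-leaf : ∀ t t′ → IsLeaf {h} {k} t′ → Ancestor t t′ → BranchEdge t t′
    edge-to-leaf ([] , _) ([] , _) leaf _ with () ← suc-injective leaf
    edge-to-leaf ([] , _) (j ∷ u , p′) leaf _ with attach-edge (Φ (j ∷ u)) (Φ-leaf-length {j ∷ u} {p′} leaf)
    ... | y , y∈leaf , a~y = attach (Φ (j ∷ u)) , y , a∈S , y∈br , (inj₁ a∈S , branch⊆Vertex {j ∷ u , p′} y∈br , a~y)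
      where
        a∈S = Φ-leaf j u (suc-injective (suc-injective leaf))
        y∈br = subst (λ t → brM t y) (node-≡ refl) y∈leaf
    edge-to-leaf (i ∷ u , p) ([] , _) leaf (_ , _ , ())
    edge-to-leaf (i ∷ u , p) (j ∷ u′ , p′) leaf (s , s≢[] , i∷u++s≡j∷u′)
      with edges {embed (i ∷ u , p)} {embed (j ∷ u′ , p′)} (inj₁ (cong suc (Φ-leaf-length {j ∷ u′} {p′} leaf) , ancestor))
      where
        ancestor : Ancestor {h} {K} (embed (i ∷ u , p)) (embed (j ∷ u′ , p′))
        ancestor with proper-prefix-preserved Φ Φ-length Φ-take (i ∷ u) s s≢[]
        ... | s′ , s′≢[] , prefix = s′ , s′≢[] , trans prefix (cong Φ i∷u++s≡j∷u′)
    ... | a , c , a∈br , c∈br , a~c = a , c , a∈br , c∈br , (branch⊆Vertex {i ∷ u , p} a∈br , branch⊆Vertex {j ∷ u′ , p′} c∈br , a~c)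

    flip : ∀ {t t′} → BranchEdge t′ t → BranchEdge t t′
    flip (a , c , a∈br , c∈br , (va , vc , a~c)) = c , a , c∈br , a∈br , (vc , va , adj-sym G a~c)

    model : MinorModel half (TNode h k) (WAdj h k)
    model = record
      { branch = branch
      ; inS = λ {t} → branch⊆Vertex {t}
      ; nonempty = branch-nonempty
      ; disjoint = λ {t} {t′} → branch-disjoint {t} {t′}
      ; connected = λ {t} → branch-connected {t}
      ; edges = λ { {t} {t′} (inj₁ (leaf , anc)) → edge-to-leaf t t′ leaf anc
                  ; {t} {t′} (inj₂ (leaf , anc)) → flip {t} {t′} (edge-to-leaf t′ t leaf anc) } }

  module HalfA = Half A A⊆R A-conn b root∈A σ σ-inj σ-in
  module HalfB = Half B B⊆R B-conn hinge hinge∈B τ τ-inj τ-in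

  halves-meet : ∀ {x} → HalfA.Vertex x → HalfB.Vertex x → x ≡ hinge
  halves-meet (inj₁ x∈A) (inj₁ x∈B) = A∩B x∈A x∈B
  halves-meet (inj₁ x∈A) (inj₂ (_ , _ , _ , x∈br)) = ⊥-elim (apart-from-R (A⊆R x∈A) x∈br)
  halves-meet (inj₂ (_ , _ , _ , x∈br)) (inj₁ x∈B) = ⊥-elim (apart-from-R (B⊆R x∈B) x∈br)
  halves-meet (inj₂ (i , _ , _ , x∈br)) (inj₂ (j , _ , _ , x∈br′)) =
    ⊥-elim (apart i j (∷-injectiveˡ (cong proj₁ (disjoint x∈br x∈br′))))

-- The two halves are models of W⟨h, k⟩ whose vertex sets meet only in the hinge.
lemma10 : (h k : ℕ) → 2 ≤ h → 1 ≤ k → (n : ℕ) → (G : Graph (Fin n)) →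
    HasMinor (whole G) (TNode h (6 * k)) (WAdj h (6 * k)) →
    Σ (Subgraph G) λ G′ → Σ (Subgraph G) λ G″ →
    HasMinor G′ (TNode h k) (WAdj h k) ×
    HasMinor G″ (TNode h k) (WAdj h k) ×
    ((a b : Fin n) → inV G′ a → inV G″ a → inV G′ b → inV G″ b → a ≡ b)
lemma10 (suc (suc d)) k (s≤s (s≤s z≤n)) _ n G M =
  HalfA.half , HalfB.half , HalfA.model , HalfB.model ,
  λ a c a∈A a∈B c∈A c∈B → trans (halves-meet a∈A a∈B) (sym (halves-meet c∈A c∈B))
  where open Assembly d k n G M
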